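{- Fix positive integers $h,m$. Every non-constant boolean function computed by a $\mathrm{CC}_h[m]$-circuit $\Gamma$ has balance at least $2^{1-\gamma_{h,m}^{ -1}(|\Gamma|)}$.
   Context: For $A\subseteq\{0,\dots,m-1\}$, the gate $\mathrm{MOD}_m^A$ (unbounded fan-in) outputs $1$ iff the sum of its boolean inputs modulo $m$ lies in $A$; multiple wires are allowed. A $\mathrm{CC}_h[m]$-circuit is a depth-$h$ circuit built of gates $\mathrm{MOD}_m^A$; $|\Gamma|$ is its number of gates. $\gamma_{h,m}(n)$ denotes the size of the smallest $\mathrm{CC}_h[m]$-circuit computing $\mathrm{AND}_n$ (a partial increasing function), and $\gamma_{h,m}^{ -1}(k)$ is the largest $n$ with $\gamma_{h,m}(n)\le k$. The balance of an $n$-ary boolean function $f$ is $1-\frac{\left|\,|f^{ -1}(0)|-|f^{ -1}(1)|\,\right|}{2^n}$. -}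

module Defs where

open import Data.Nat using (ℕ; zero; suc; _+_; _*_; _∸_; _^_; _≤_; _⊔_; NonZero; ∣_-_∣)
open import Data.Nat.DivMod using (_mod_)
open import Data.Bool using (Bool; true; false; if_then_else_; _∧_; not)
open import Data.Fin using (Fin; zero; suc)
open import Data.Fin.Subset using (Subset)
open import Data.Vec using (Vec; []; _∷_; lookup)
open import Data.Product using (Σ; _×_; ∃)
open import Relation.Binary.PropositionalEquality using (_≡_; _≢_)

b2n : Bool → ℕ
b2n true  = 1
b2n false = 0

sumF : ∀ {k} → (Fin k → ℕ) → ℕ
sumF {zero}  f = 0
sumF {suc k} f = f zero + sumF (λ i → f (suc i))

maxF : ∀ {k} → (Fin k → ℕ) → ℕ
maxF {zero}  f = 0
maxF {suc k} f = f zero ⊔ maxF (λ i → f (suc i))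

-- A MOD_m^A gate inside a circuit with n inputs and k earlier gates.
-- acc is A ⊆ {0,…,m-1}; inW i / gW j are the wire multiplicities from
-- input i / earlier gate j (multiple wires allowed, 0 = no wire).
record Gate (m n k : ℕ) : Set where
  field
    acc : Subset m
    inW : Fin n → ℕ
    gW  : Fin k → ℕ
open Gate public

-- A circuit (DAG) with n inputs and k gates listed in topological order;
-- the most recently added gate has index zero.
data Circ (m n : ℕ) : ℕ → Set where
  []  : Circ m n 0
  _▷_ : ∀ {k} → Circ m n k → Gate m n k → Circ m n (suc k)

module _ {m : ℕ} {{_ : NonZero m}} where

  gateVal : ∀ {n k} → Gate m n k → Vec Bool n → (Fin k → Bool) → Bool
  gateVal g x v =
    lookup (acc g)
      ((sumF (λ i → inW g i * b2n (lookup x i)) + sumF (λ j → gW g j * b2n (v j))) mod m)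

  vals : ∀ {n k} → Circ m n k → Vec Bool n → Fin k → Bool
  vals (C ▷ g) x zero    = gateVal g x (vals C x)
  vals (C ▷ g) x (suc j) = vals C x j

  out : ∀ {n k} → Circ m n (suc k) → Vec Bool n → Bool
  out C x = vals C x zero

depths : ∀ {m n k} → Circ m n k → Fin k → ℕ
depths (C ▷ g) zero    = suc (maxF (λ j → if-pos (gW g j) (depths C j)))
  where
    if-pos : ℕ → ℕ → ℕ
    if-pos zero    d = 0
    if-pos (suc _) d = d
depths (C ▷ g) (suc j) = depths C j

depth : ∀ {m n k} → Circ m n (suc k) → ℕ
depth C = depths C zero

size : ∀ {m n k} → Circ m n k → ℕ
size {k = k} _ = k

andV : ∀ {n} → Vec Bool n → Bool
andV []       = true
andV (b ∷ bs) = b ∧ andV bs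

-- "γ_{h,m}(n) ≤ s": some CC_h[m]-circuit with at most s gates computes AND_n
ANDWithin : (h m : ℕ) {{_ : NonZero m}} → (n s : ℕ) → Set
ANDWithin h m n s =
  Σ ℕ λ j → suc j ≤ s × Σ (Circ m n (suc j)) λ C → depth C ≤ h × (∀ x → out C x ≡ andV x)

-- N = γ_{h,m}^{-1}(s): the largest n with γ_{h,m}(n) ≤ s
IsGammaInv : (h m : ℕ) {{_ : NonZero m}} → (s N : ℕ) → Set
IsGammaInv h m s N = ANDWithin h m N s × (∀ n → ANDWithin h m n s → n ≤ N)

ones : ∀ n → (Vec Bool n → Bool) → ℕ
ones zero    f = b2n (f [])
ones (suc n) f = ones n (λ x → f (true ∷ x)) + ones n (λ x → f (false ∷ x))

zeros : ∀ n → (Vec Bool n → Bool) → ℕ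
zeros n f = ones n (λ x → not (f x))

-- 2^n · balance(f) = 2^n − | |f⁻¹(0)| − |f⁻¹(1)| |
scaledBalance : ∀ n → (Vec Bool n → Bool) → ℕ
scaledBalance n f = 2 ^ n ∸ ∣ zeros n f - ones n f ∣

NonConstant : ∀ {n} → (Vec Bool n → Bool) → Set
NonConstant f = ∃ λ x → ∃ λ y → f x ≢ f y

{-# OPTIONS --safe #-}
-- Substituting constants and literals for the inputs of a CC_h[m]-circuit yields a circuit of the
-- same size and depth, since a literal ¬y only changes the wire weights and shifts the accepted
-- residues. Every f with a true point restricts to AND_d with |f⁻¹(1)| ≥ 2^(n-d): walk through the
-- variables, keeping x₀ as a literal when one of its cofactors vanishes and otherwise fixing it to
-- the sparser cofactor. Then d ≤ N = γ⁻¹(|Γ|), and the same holds for ¬f after negating the output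
-- gate, so min(|f⁻¹(0)|, |f⁻¹(1)|) ≥ 2^(n-N), while 2^n · balance(f) = 2 min(|f⁻¹(0)|, |f⁻¹(1)|).
module Submission where

open import Defs
open import Data.Bool using (Bool; true; false; not; if_then_else_)
open import Data.Bool.Properties using (not-injective)
open import Data.Empty using (⊥-elim)
open import Data.Fin using (Fin; zero; suc; toℕ)
open import Data.Fin.Properties using (fromℕ<-cong; toℕ-fromℕ<)
open import Data.Nat using (ℕ; zero; suc; _+_; _*_; _∸_; _^_; _≤_; _⊔_; _⊓_; _%_; ∣_-_∣; _≟_; NonZero)
open import Data.Nat.DivMod using (_mod_; m%n<n; m%n%n≡m%n; %-distribˡ-+; [m+kn]%n≡m%n)
open import Data.Nat.Properties
open import Algebra.Properties.CommutativeSemigroup +-commutativeSemigroup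
  using () renaming (interchange to +-interchange; xy∙z≈xz∙y to +-rightComm)
open import Algebra.Properties.CommutativeSemigroup *-commutativeSemigroup
  using () renaming (x∙yz≈y∙xz to *-leftComm)
open import Data.Nat.Solver using (module +-*-Solver)
open import Data.Product using (_,_)
open import Data.Sum using (inj₁; inj₂)
open import Data.Vec using (Vec; []; _∷_; lookup; tabulate; map)
open import Data.Vec.Properties using (lookup∘tabulate; tabulate-cong; lookup-map)
import Data.Vec.Functional as Vector
open import Function using (_∘_)
open import Relation.Binary.PropositionalEquality
open import Relation.Nullary using (yes; no)

sumF-cong : ∀ {k} {f g : Fin k → ℕ} → (∀ i → f i ≡ g i) → sumF f ≡ sumF g
sumF-cong {zero}  _   = refl
sumF-cong {suc k} f≗g = cong₂ _+_ (f≗g zero) (sumF-cong (f≗g ∘ suc))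

sumF-zero : ∀ k → sumF {k} (λ _ → 0) ≡ 0
sumF-zero zero    = refl
sumF-zero (suc k) = sumF-zero k

sumF-distrib-+ : ∀ {k} (f g : Fin k → ℕ) → sumF (λ i → f i + g i) ≡ sumF f + sumF g
sumF-distrib-+ {zero}  f g = refl
sumF-distrib-+ {suc k} f g = begin
  f zero + g zero + sumF (λ i → f (suc i) + g (suc i))
    ≡⟨ cong (f zero + g zero +_) (sumF-distrib-+ (f ∘ suc) (g ∘ suc)) ⟩
  f zero + g zero + (sumF (f ∘ suc) + sumF (g ∘ suc))
    ≡⟨ +-interchange (f zero) (g zero) _ _ ⟩
  f zero + sumF (f ∘ suc) + (g zero + sumF (g ∘ suc)) ∎
  where open ≡-Reasoning

sumF-distribʳ-* : ∀ {k} (f : Fin k → ℕ) c → sumF f * c ≡ sumF (λ i → f i * c)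
sumF-distribʳ-* {zero}  f c = refl
sumF-distribʳ-* {suc k} f c =
  trans (*-distribʳ-+ c (f zero) _) (cong (f zero * c +_) (sumF-distribʳ-* (f ∘ suc) c))

sumF-comm : ∀ {a b} (F : Fin a → Fin b → ℕ) →
  sumF (λ i → sumF (F i)) ≡ sumF (λ j → sumF (λ i → F i j))
sumF-comm {zero}  {b} F = sym (sumF-zero b)
sumF-comm {suc a} {b} F = begin
  sumF (F zero) + sumF (λ i → sumF (F (suc i)))
    ≡⟨ cong (sumF (F zero) +_) (sumF-comm (F ∘ suc)) ⟩
  sumF (F zero) + sumF (λ j → sumF (λ i → F (suc i) j))
    ≡⟨ sumF-distrib-+ (F zero) (λ j → sumF (λ i → F (suc i) j)) ⟨
  sumF (λ j → F zero j + sumF (λ i → F (suc i) j)) ∎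
  where open ≡-Reasoning

single : ∀ {d} → Fin d → ℕ → Fin d → ℕ
single zero    a zero    = a
single zero    a (suc _) = 0
single (suc _) a zero    = 0
single (suc j) a (suc i) = single j a i

sumF-single : ∀ {d} (j : Fin d) a (v : Fin d → ℕ) → sumF (λ i → single j a i * v i) ≡ a * v j
sumF-single {suc d} zero    a v = trans (cong (a * v zero +_) (sumF-zero d)) (+-identityʳ _)
sumF-single {suc d} (suc j) a v = sumF-single j a (v ∘ suc)

weightedSum : ∀ {k} → (Fin k → ℕ) → (Fin k → Bool) → ℕ
weightedSum w x = sumF (λ i → w i * b2n (x i))

weightedSum-sumF : ∀ {a b} (F : Fin a → Fin b → ℕ) (x : Fin b → Bool) →
  weightedSum (λ j → sumF (λ i → F i j)) x ≡ sumF (λ i → weightedSum (F i) x)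
weightedSum-sumF F x =
  trans (sumF-cong (λ j → sumF-distribʳ-* (λ i → F i j) (b2n (x j)))) (sym (sumF-comm (λ i j → F i j * b2n (x j))))

data Literal (d : ℕ) : Set where
  const : Bool → Literal d
  var   : Fin d → Literal d
  neg   : Fin d → Literal d

evalLit : ∀ {d} → Literal d → Vec Bool d → Bool
evalLit (const b) y = b
evalLit (var j)   y = lookup y j
evalLit (neg j)   y = not (lookup y j)

shiftLit : ∀ {d} → Literal d → Literal (suc d)
shiftLit (const b) = const b
shiftLit (var j)   = var (suc j)
shiftLit (neg j)   = neg (suc j)

evalLit-shift : ∀ {d} (l : Literal d) b y → evalLit (shiftLit l) (b ∷ y) ≡ evalLit l y
evalLit-shift (const _) b y = refl
evalLit-shift (var _)   b y = refl
evalLit-shift (neg _)   b y = refl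

Restriction : ℕ → ℕ → Set
Restriction n d = Vector.Vector (Literal d) n

restrict : ∀ {n d} → Restriction n d → Vec Bool d → Vec Bool n
restrict ρ y = tabulate (λ i → evalLit (ρ i) y)

restrict-shift : ∀ {n d} (ρ : Restriction n d) b y →
  restrict (Vector.map shiftLit ρ) (b ∷ y) ≡ restrict ρ y
restrict-shift ρ b y = tabulate-cong (λ i → evalLit-shift (ρ i) b y)

-- 1 - x ≡ (m - 1) x + 1 (mod m): a negated literal of weight w becomes weight w (m - 1) on the
-- variable plus the constant w, with w x as the carry.
negatedLiteral-sum : ∀ m .{{_ : NonZero m}} w b →
  w * (m ∸ 1) * b2n b + w ≡ w * b2n (not b) + w * b2n b * m
negatedLiteral-sum (suc m) w false =
  solve 2 (λ w m → w :* m :* con 0 :+ w := w :* con 1 :+ w :* con 0 :* (con 1 :+ m)) refl w m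
  where open +-*-Solver
negatedLiteral-sum (suc m) w true =
  solve 2 (λ w m → w :* m :* con 1 :+ w := w :* con 0 :+ w :* con 1 :* (con 1 :+ m)) refl w m
  where open +-*-Solver

module _ {m : ℕ} {{_ : NonZero m}} where

  litWeight : ∀ {d} → Literal d → ℕ → Fin d → ℕ
  litWeight (const _) w _ = 0
  litWeight (var j)   w   = single j w
  litWeight (neg j)   w   = single j (w * (m ∸ 1))

  litOffset : ∀ {d} → Literal d → ℕ → ℕ
  litOffset (const b) w = w * b2n b
  litOffset (var _)   w = 0
  litOffset (neg _)   w = w

  litCarry : ∀ {d} → Literal d → ℕ → Vec Bool d → ℕ
  litCarry (neg j) w y = w * b2n (lookup y j)
  litCarry _       _ _ = 0

  literal-sum : ∀ {d} (l : Literal d) w (y : Vec Bool d) →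
    weightedSum (litWeight l w) (lookup y) + litOffset l w ≡ w * b2n (evalLit l y) + litCarry l w y * m
  literal-sum {d} (const b) w y = trans (cong (_+ w * b2n b) (sumF-zero d)) (sym (+-identityʳ _))
  literal-sum (var j) w y = cong (_+ 0) (sumF-single j w (b2n ∘ lookup y))
  literal-sum (neg j) w y =
    trans (cong (_+ w) (sumF-single j (w * (m ∸ 1)) (b2n ∘ lookup y))) (negatedLiteral-sum m w (lookup y j))

  restrictWeight : ∀ {n d} → Restriction n d → (Fin n → ℕ) → Fin d → ℕ
  restrictWeight ρ w j = sumF (λ i → litWeight (ρ i) (w i) j)

  restrictOffset : ∀ {n d} → Restriction n d → (Fin n → ℕ) → ℕ
  restrictOffset ρ w = sumF (λ i → litOffset (ρ i) (w i))

  weightedSum-restrict : ∀ {n d} (ρ : Restriction n d) (w : Fin n → ℕ) (y : Vec Bool d) →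
    weightedSum (restrictWeight ρ w) (lookup y) + restrictOffset ρ w
    ≡ weightedSum w (lookup (restrict ρ y)) + sumF (λ i → litCarry (ρ i) (w i) y) * m
  weightedSum-restrict {n} ρ w y = begin
    weightedSum (restrictWeight ρ w) (lookup y) + restrictOffset ρ w
      ≡⟨ cong (_+ restrictOffset ρ w) (weightedSum-sumF (λ i → litWeight (ρ i) (w i)) (lookup y)) ⟩
    sumF (λ i → weightedSum (litWeight (ρ i) (w i)) (lookup y)) + restrictOffset ρ w
      ≡⟨ sumF-distrib-+ {n} _ _ ⟨
    sumF (λ i → weightedSum (litWeight (ρ i) (w i)) (lookup y) + litOffset (ρ i) (w i))
      ≡⟨ sumF-cong (λ i → literal-sum (ρ i) (w i) y) ⟩
    sumF (λ i → w i * b2n (evalLit (ρ i) y) + litCarry (ρ i) (w i) y * m)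
      ≡⟨ sumF-distrib-+ {n} _ _ ⟩
    sumF (λ i → w i * b2n (evalLit (ρ i) y)) + sumF (λ i → litCarry (ρ i) (w i) y * m)
      ≡⟨ cong₂ _+_ (sumF-cong (λ i → cong (λ b → w i * b2n b) (sym (lookup∘tabulate _ i))))
                   (sym (sumF-distribʳ-* (λ i → litCarry (ρ i) (w i) y) m)) ⟩
    weightedSum w (lookup (restrict ρ y)) + sumF (λ i → litCarry (ρ i) (w i) y) * m ∎
    where open ≡-Reasoning

  mod-cong : ∀ a b → a % m ≡ b % m → a mod m ≡ b mod m
  mod-cong a b a≡b = fromℕ<-cong _ _ a≡b (m%n<n a m) (m%n<n b m)

  toℕ-mod-+ : ∀ a c → (toℕ (a mod m) + c) % m ≡ (a + c) % m
  toℕ-mod-+ a c = begin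
    (toℕ (a mod m) + c) % m    ≡⟨ cong (λ r → (r + c) % m) (toℕ-fromℕ< (m%n<n a m)) ⟩
    (a % m + c) % m            ≡⟨ %-distribˡ-+ (a % m) c m ⟩
    (a % m % m + c % m) % m    ≡⟨ cong (λ r → (r + c % m) % m) (m%n%n≡m%n a m) ⟩
    (a % m + c % m) % m        ≡⟨ %-distribˡ-+ a c m ⟨
    (a + c) % m ∎
    where open ≡-Reasoning

  restrictGate : ∀ {n d k} → Restriction n d → Gate m n k → Gate m d k
  restrictGate ρ g = record
    { acc = tabulate (λ r → lookup (acc g) ((toℕ r + restrictOffset ρ (inW g)) mod m))
    ; inW = restrictWeight ρ (inW g)
    ; gW  = gW g
    }

  gateVal-restrict : ∀ {n d k} (ρ : Restriction n d) (g : Gate m n k) y (v : Fin k → Bool) →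
    gateVal (restrictGate ρ g) y v ≡ gateVal g (restrict ρ y) v
  gateVal-restrict ρ g y v =
    trans (lookup∘tabulate _ ((S′ + G) mod m)) (cong (lookup (acc g)) (mod-cong _ _ sums≡))
    where
    open ≡-Reasoning
    S′ = weightedSum (restrictWeight ρ (inW g)) (lookup y)
    c  = restrictOffset ρ (inW g)
    S  = weightedSum (inW g) (lookup (restrict ρ y))
    q  = sumF (λ i → litCarry (ρ i) (inW g i) y)
    G  = weightedSum (gW g) v
    sums≡ : (toℕ ((S′ + G) mod m) + c) % m ≡ (S + G) % m
    sums≡ = begin
      (toℕ ((S′ + G) mod m) + c) % m ≡⟨ toℕ-mod-+ (S′ + G) c ⟩
      (S′ + G + c) % m               ≡⟨ cong (_% m) (+-rightComm S′ G c) ⟩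
      (S′ + c + G) % m               ≡⟨ cong (λ t → (t + G) % m) (weightedSum-restrict ρ (inW g) y) ⟩
      (S + q * m + G) % m            ≡⟨ cong (_% m) (+-rightComm S (q * m) G) ⟩
      (S + G + q * m) % m            ≡⟨ [m+kn]%n≡m%n (S + G) q m ⟩
      (S + G) % m ∎

  gateVal-cong : ∀ {n k} (g : Gate m n k) x {v v′ : Fin k → Bool} →
    (∀ j → v j ≡ v′ j) → gateVal g x v ≡ gateVal g x v′
  gateVal-cong g x v≗v′ =
    cong (λ s → lookup (acc g) ((weightedSum (inW g) (lookup x) + s) mod m))
         (sumF-cong (λ j → cong (λ b → gW g j * b2n b) (v≗v′ j)))

  restrictCirc : ∀ {n d k} → Restriction n d → Circ m n k → Circ m d k
  restrictCirc ρ []      = []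
  restrictCirc ρ (C ▷ g) = restrictCirc ρ C ▷ restrictGate ρ g

  vals-restrict : ∀ {n d k} (ρ : Restriction n d) (C : Circ m n k) y j →
    vals (restrictCirc ρ C) y j ≡ vals C (restrict ρ y) j
  vals-restrict ρ (C ▷ g) y zero =
    trans (gateVal-cong (restrictGate ρ g) y (vals-restrict ρ C y)) (gateVal-restrict ρ g y _)
  vals-restrict ρ (C ▷ g) y (suc j) = vals-restrict ρ C y j

  negateGate : ∀ {n k} → Gate m n k → Gate m n k
  negateGate g = record { acc = map not (acc g) ; inW = inW g ; gW = gW g }

  negateOutput : ∀ {n k} → Circ m n (suc k) → Circ m n (suc k)
  negateOutput (C ▷ g) = C ▷ negateGate g

  out-negateOutput : ∀ {n k} (C : Circ m n (suc k)) x → out (negateOutput C) x ≡ not (out C x)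
  out-negateOutput (C ▷ g) x = lookup-map _ not (acc g)

maxF-cong : ∀ {k} {f g : Fin k → ℕ} → (∀ i → f i ≡ g i) → maxF f ≡ maxF g
maxF-cong {zero}  _   = refl
maxF-cong {suc k} f≗g = cong₂ _⊔_ (f≗g zero) (maxF-cong (f≗g ∘ suc))

wiredDepth : ℕ → ℕ → ℕ
wiredDepth zero    _ = 0
wiredDepth (suc _) d = d

-- The `_` is the local if-pos of depths, which cannot be named here; it is solved from the use
-- in depths-▷, hence the mutual block.
mutual
  depths-▷ : ∀ {m n k} (C : Circ m n k) (g : Gate m n k) →
    depths (C ▷ g) zero ≡ suc (maxF (λ j → wiredDepth (gW g j) (depths C j)))
  depths-▷ C g = cong suc (maxF-cong (if-pos≡wiredDepth C g))

  if-pos≡wiredDepth : ∀ {m n k} (C : Circ m n k) (g : Gate m n k) j →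
    _ ≡ wiredDepth (gW g j) (depths C j)
  if-pos≡wiredDepth C g j with gW g j
  ... | zero  = refl
  ... | suc _ = refl

depths-▷-cong : ∀ {m m′ n n′ k} (C : Circ m n k) (C′ : Circ m′ n′ k) (g : Gate m n k) (g′ : Gate m′ n′ k) →
  (∀ j → depths C j ≡ depths C′ j) → (∀ j → gW g j ≡ gW g′ j) →
  depths (C ▷ g) zero ≡ depths (C′ ▷ g′) zero
depths-▷-cong C C′ g g′ sameDepths sameWires = begin
  depths (C ▷ g) zero
    ≡⟨ depths-▷ C g ⟩
  suc (maxF (λ j → wiredDepth (gW g j) (depths C j)))
    ≡⟨ cong suc (maxF-cong (λ j → cong₂ wiredDepth (sameWires j) (sameDepths j))) ⟩
  suc (maxF (λ j → wiredDepth (gW g′ j) (depths C′ j)))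
    ≡⟨ depths-▷ C′ g′ ⟨
  depths (C′ ▷ g′) zero ∎
  where open ≡-Reasoning

module _ {m : ℕ} {{_ : NonZero m}} where

  depths-restrict : ∀ {n d k} (ρ : Restriction n d) (C : Circ m n k) j →
    depths (restrictCirc ρ C) j ≡ depths C j
  depths-restrict ρ (C ▷ g) zero =
    depths-▷-cong (restrictCirc ρ C) C (restrictGate ρ g) g (depths-restrict ρ C) (λ _ → refl)
  depths-restrict ρ (C ▷ g) (suc j) = depths-restrict ρ C j

  depth-negateOutput : ∀ {n k} (C : Circ m n (suc k)) → depth (negateOutput C) ≡ depth C
  depth-negateOutput (C ▷ g) = depths-▷-cong C C (negateGate g) g (λ _ → refl) (λ _ → refl)

  andWithin-restrict : ∀ {h n d k} (Γ : Circ m n (suc k)) → depth Γ ≤ h →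
    (f : Vec Bool n → Bool) → (∀ x → out Γ x ≡ f x) →
    (ρ : Restriction n d) → (∀ y → f (restrict ρ y) ≡ andV y) → ANDWithin h m d (suc k)
  andWithin-restrict {k = k} Γ depth≤h f Γ≗f ρ f∘ρ≗and =
    k , ≤-refl , restrictCirc ρ Γ , ≤-trans (≤-reflexive (depths-restrict ρ Γ zero)) depth≤h ,
    λ y → trans (vals-restrict ρ Γ y zero) (trans (Γ≗f (restrict ρ y)) (f∘ρ≗and y))

b2n-positive : ∀ {b} → 1 ≤ b2n b → b ≡ true
b2n-positive {true} _ = refl

cofactor : ∀ {n} → (Vec Bool (suc n) → Bool) → Bool → Vec Bool n → Bool
cofactor f b x = f (b ∷ x)

ones≡0⇒false : ∀ n (f : Vec Bool n → Bool) → ones n f ≡ 0 → ∀ x → f x ≡ false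
ones≡0⇒false zero f ones≡0 [] with f []
... | false = refl
ones≡0⇒false zero f () [] | true
ones≡0⇒false (suc n) f ones≡0 (true ∷ x)  = ones≡0⇒false n (cofactor f true) (m+n≡0⇒m≡0 _ ones≡0) x
ones≡0⇒false (suc n) f ones≡0 (false ∷ x) = ones≡0⇒false n (cofactor f false) (m+n≡0⇒n≡0 _ ones≡0) x

nonConstant⇒ones>0 : ∀ n (f : Vec Bool n → Bool) x y → f x ≢ f y → 1 ≤ ones n f
nonConstant⇒ones>0 n f x y fx≢fy with ones n f ≟ 0
... | yes ones≡0 = ⊥-elim (fx≢fy (trans (ones≡0⇒false n f ones≡0 x) (sym (ones≡0⇒false n f ones≡0 y))))
... | no  ones≢0 = n≢0⇒n>0 ones≢0

zeros+ones : ∀ n (f : Vec Bool n → Bool) → zeros n f + ones n f ≡ 2 ^ n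
zeros+ones zero f with f []
... | true  = refl
... | false = refl
zeros+ones (suc n) f = begin
  zeros n f₁ + zeros n f₀ + (ones n f₁ + ones n f₀) ≡⟨ +-interchange (zeros n f₁) _ _ _ ⟩
  zeros n f₁ + ones n f₁ + (zeros n f₀ + ones n f₀) ≡⟨ cong₂ _+_ (zeros+ones n f₁) (zeros+ones n f₀) ⟩
  2 ^ n + 2 ^ n                                     ≡⟨ cong (2 ^ n +_) (+-identityʳ (2 ^ n)) ⟨
  2 ^ suc n ∎
  where
  open ≡-Reasoning
  f₁ = cofactor f true
  f₀ = cofactor f false

ones-cofactors : ∀ {n} (f : Vec Bool (suc n) → Bool) b →
  ones (suc n) f ≡ ones n (cofactor f b) + ones n (cofactor f (not b))
ones-cofactors f true  = refl
ones-cofactors {n} f false = +-comm (ones n (cofactor f true)) (ones n (cofactor f false))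

ones-soleCofactor : ∀ {n} (f : Vec Bool (suc n) → Bool) b →
  ones n (cofactor f (not b)) ≡ 0 → ones (suc n) f ≡ ones n (cofactor f b)
ones-soleCofactor {n} f b other≡0 =
  trans (ones-cofactors f b) (trans (cong (ones n (cofactor f b) +_) other≡0) (+-identityʳ _))

record ANDRestriction (n : ℕ) (f : Vec Bool n → Bool) : Set where
  field
    dim         : ℕ
    ρ           : Restriction n dim
    computesAND : ∀ y → f (restrict ρ y) ≡ andV y
    density     : 2 ^ n ≤ ones n f * 2 ^ dim

literal₀ : ∀ {d} → Bool → Literal (suc d)
literal₀ true  = var zero
literal₀ false = neg zero

restrict-literal₀ : ∀ {n d} b (ρ : Restriction n d) c y →
  restrict (literal₀ b Vector.∷ Vector.map shiftLit ρ) (c ∷ y) ≡ (if c then b else not b) ∷ restrict ρ y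
restrict-literal₀ b ρ c y = cong₂ _∷_ (evalLit-literal₀ b c) (restrict-shift ρ c y)
  where
  evalLit-literal₀ : ∀ b c → evalLit (literal₀ b) (c ∷ y) ≡ (if c then b else not b)
  evalLit-literal₀ true  true  = refl
  evalLit-literal₀ true  false = refl
  evalLit-literal₀ false true  = refl
  evalLit-literal₀ false false = refl

double-* : ∀ a b → 2 * (a * b) ≡ (a + a) * b
double-* a b = trans (cong (a * b +_) (+-identityʳ (a * b))) (sym (*-distribʳ-+ b a a))

keepVariable : ∀ {n} (f : Vec Bool (suc n) → Bool) b →
  ones n (cofactor f (not b)) ≡ 0 → ANDRestriction n (cofactor f b) → ANDRestriction (suc n) f
keepVariable {n} f b other≡0 r = record
  { dim         = suc dim
  ; ρ           = literal₀ b Vector.∷ Vector.map shiftLit ρ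
  ; computesAND = λ where
      (true ∷ y)  → trans (cong f (restrict-literal₀ b ρ true y)) (computesAND y)
      (false ∷ y) → trans (cong f (restrict-literal₀ b ρ false y))
                          (ones≡0⇒false n (cofactor f (not b)) other≡0 (restrict ρ y))
  ; density     = begin
      2 * 2 ^ n               ≤⟨ *-monoʳ-≤ 2 density ⟩
      2 * (a * 2 ^ dim)       ≡⟨ *-leftComm 2 a (2 ^ dim) ⟩
      a * 2 ^ suc dim         ≡⟨ cong (_* 2 ^ suc dim) (ones-soleCofactor f b other≡0) ⟨
      ones (suc n) f * 2 ^ suc dim ∎
  }
  where
  open ANDRestriction r
  open ≤-Reasoning
  a = ones n (cofactor f b)

fixVariable : ∀ {n} (f : Vec Bool (suc n) → Bool) b →
  ones n (cofactor f b) ≤ ones n (cofactor f (not b)) → ANDRestriction n (cofactor f b) → ANDRestriction (suc n) f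
fixVariable {n} f b fewer r = record
  { dim         = dim
  ; ρ           = const b Vector.∷ ρ
  ; computesAND = computesAND
  ; density     = begin
      2 * 2 ^ n                    ≤⟨ *-monoʳ-≤ 2 density ⟩
      2 * (a * 2 ^ dim)            ≡⟨ double-* a (2 ^ dim) ⟩
      (a + a) * 2 ^ dim            ≤⟨ *-monoˡ-≤ (2 ^ dim) (+-monoʳ-≤ a fewer) ⟩
      (a + ones n (cofactor f (not b))) * 2 ^ dim ≡⟨ cong (_* 2 ^ dim) (ones-cofactors f b) ⟨
      ones (suc n) f * 2 ^ dim ∎
  }
  where
  open ANDRestriction r
  open ≤-Reasoning
  a = ones n (cofactor f b)

andRestriction : ∀ n (f : Vec Bool n → Bool) → 1 ≤ ones n f → ANDRestriction n f
andRestriction zero f pos = record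
  { dim         = 0
  ; ρ           = Vector.[]
  ; computesAND = λ { [] → b2n-positive pos }
  ; density     = subst (1 ≤_) (sym (*-identityʳ _)) pos
  }
andRestriction (suc n) f pos with ones n (cofactor f false) ≟ 0 | ones n (cofactor f true) ≟ 0
... | yes f₀≡0 | _ =
  keepVariable f true f₀≡0 (andRestriction n _ (subst (1 ≤_) (ones-soleCofactor f true f₀≡0) pos))
... | no _ | yes f₁≡0 =
  keepVariable f false f₁≡0 (andRestriction n _ (subst (1 ≤_) (ones-soleCofactor f false f₁≡0) pos))
... | no f₀≢0 | no f₁≢0 with ≤-total (ones n (cofactor f true)) (ones n (cofactor f false))
...   | inj₁ f₁≤f₀ = fixVariable f true f₁≤f₀ (andRestriction n _ (n≢0⇒n>0 f₁≢0))
...   | inj₂ f₀≤f₁ = fixVariable f false f₀≤f₁ (andRestriction n _ (n≢0⇒n>0 f₀≢0))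

ones-density : ∀ n (f : Vec Bool n → Bool) N →
  (∀ {d} (ρ : Restriction n d) → (∀ y → f (restrict ρ y) ≡ andV y) → d ≤ N) →
  1 ≤ ones n f → 2 ^ n ≤ ones n f * 2 ^ N
ones-density n f N andDim≤N pos =
  ≤-trans density (*-monoʳ-≤ (ones n f) (^-monoʳ-≤ 2 (andDim≤N ρ computesAND)))
  where open ANDRestriction (andRestriction n f pos)

≤⇒+-∸-∣-∣ : ∀ {a b} → a ≤ b → a + b ∸ ∣ a - b ∣ ≡ a ⊓ b + a ⊓ b
≤⇒+-∸-∣-∣ {a} {b} a≤b = begin
  a + b ∸ ∣ a - b ∣   ≡⟨ cong (a + b ∸_) (m≤n⇒∣m-n∣≡n∸m a≤b) ⟩
  a + b ∸ (b ∸ a)     ≡⟨ +-∸-assoc a (m∸n≤m b a) ⟩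
  a + (b ∸ (b ∸ a))   ≡⟨ cong (a +_) (m∸[m∸n]≡n a≤b) ⟩
  a + a               ≡⟨ cong (λ t → t + t) (m≤n⇒m⊓n≡m a≤b) ⟨
  a ⊓ b + a ⊓ b ∎
  where open ≡-Reasoning

+-∸-∣-∣ : ∀ a b → a + b ∸ ∣ a - b ∣ ≡ a ⊓ b + a ⊓ b
+-∸-∣-∣ a b with ≤-total a b
... | inj₁ a≤b = ≤⇒+-∸-∣-∣ a≤b
... | inj₂ b≤a = begin
  a + b ∸ ∣ a - b ∣   ≡⟨ cong₂ _∸_ (+-comm a b) (∣-∣-comm a b) ⟩
  b + a ∸ ∣ b - a ∣   ≡⟨ ≤⇒+-∸-∣-∣ b≤a ⟩
  b ⊓ a + b ⊓ a       ≡⟨ cong (λ t → t + t) (⊓-comm b a) ⟩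
  a ⊓ b + a ⊓ b ∎
  where open ≡-Reasoning

balance-bound : ∀ {P} z o M → z + o ≡ P → P ≤ z * M → P ≤ o * M → 2 * P ≤ (P ∸ ∣ z - o ∣) * M
balance-bound z o M refl P≤zM P≤oM = begin
  2 * (z + o)               ≤⟨ *-monoʳ-≤ 2 (⊓-glb P≤zM P≤oM) ⟩
  2 * ((z * M) ⊓ (o * M))   ≡⟨ cong (2 *_) (*-distribʳ-⊓ M z o) ⟨
  2 * ((z ⊓ o) * M)         ≡⟨ double-* (z ⊓ o) M ⟩
  (z ⊓ o + z ⊓ o) * M       ≡⟨ cong (_* M) (+-∸-∣-∣ z o) ⟨
  (z + o ∸ ∣ z - o ∣) * M ∎
  where open ≤-Reasoning

corollary6p2 : (h m : ℕ) {{_ : NonZero m}} → 1 ≤ h →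
    ∀ {n k} (Γ : Circ m n (suc k)) → depth Γ ≤ h → NonConstant (out Γ) →
    (N : ℕ) → IsGammaInv h m (size Γ) N →
    -- balance(out Γ) ≥ 2^(1-N), multiplied through by 2^n · 2^N
    2 * 2 ^ n ≤ scaledBalance n (out Γ) * 2 ^ N
corollary6p2 h m _ {n} Γ depth≤h (x , y , fx≢fy) N (_ , maximal) =
  balance-bound (zeros n f) (ones n f) (2 ^ N) (zeros+ones n f) zerosBound onesBound
  where
  f = out Γ
  onesBound : 2 ^ n ≤ ones n f * 2 ^ N
  onesBound = ones-density n f N
    (λ ρ f∘ρ≗and → maximal _ (andWithin-restrict Γ depth≤h f (λ _ → refl) ρ f∘ρ≗and))
    (nonConstant⇒ones>0 n f x y fx≢fy)
  zerosBound : 2 ^ n ≤ zeros n f * 2 ^ N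
  zerosBound = ones-density n (not ∘ f) N
    (λ ρ f∘ρ≗and → maximal _ (andWithin-restrict (negateOutput Γ)
      (≤-trans (≤-reflexive (depth-negateOutput Γ)) depth≤h) (not ∘ f) (out-negateOutput Γ) ρ f∘ρ≗and))
    (nonConstant⇒ones>0 n (not ∘ f) x y (fx≢fy ∘ not-injective))
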